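{- Let $a\geq 3$ and $m\geq 2a^2-a+2$ be integers, let $C(m,a)=\left\lceil\frac{m-1}{a}\left\lceil\frac{m-1}{a}\right\rceil\right\rceil$, and suppose the set $\{1,\ldots,C(m,a)\}$ is colored red and blue so that there is no monochromatic solution of $x_1+\cdots+x_{m-1}=ax_m$, with $a-2$ red and $a-1$ blue. Then $a$ is red and $m-1$ is blue.
   Context: A solution is an assignment of values in $\{1,\ldots,C(m,a)\}$ to $x_1,\ldots,x_m$ (not necessarily distinct) making the equation true; it is monochromatic if all the values $x_1,\ldots,x_m$ have the same color. -}

module Defs where

open import Data.Nat using (ℕ; zero; suc; _+_; _*_; _∸_; _≤_)
open import Data.Nat.DivMod using (_/_)
open import Data.Fin using (Fin; zero; suc)
open import Data.Product using (_×_)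
open import Relation.Binary.PropositionalEquality using (_≡_)
open import Relation.Nullary using (¬_)

data Colour : Set where
  red blue : Colour

-- Ceiling division ⌈ n / d ⌉ (for d ≥ 1; the d = 0 case is a junk value never used).
ceilDiv : ℕ → ℕ → ℕ
ceilDiv n zero    = 0
ceilDiv n (suc k) = (n + k) / suc k

-- C(m,a) = ⌈ ((m-1)/a) * ⌈ (m-1)/a ⌉ ⌉ = ⌈ (m-1) * ⌈(m-1)/a⌉ / a ⌉
C : ℕ → ℕ → ℕ
C m a = ceilDiv ((m ∸ 1) * ceilDiv (m ∸ 1) a) a

sumFin : {n : ℕ} → (Fin n → ℕ) → ℕ
sumFin {zero}  f = 0
sumFin {suc n} f = f zero + sumFin (λ i → f (suc i))

InRange : ℕ → ℕ → Set
InRange N x = 1 ≤ x × x ≤ N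

-- A solution of x_1 + ⋯ + x_{m-1} = a x_m in {1,…,N}: xs gives x_1..x_{m-1}, y gives x_m.
IsSolution : (m a N : ℕ) → (Fin (m ∸ 1) → ℕ) → ℕ → Set
IsSolution m a N xs y =
  ((i : Fin (m ∸ 1)) → InRange N (xs i)) × InRange N y × sumFin xs ≡ a * y

Monochromatic : (col : ℕ → Colour) → {k : ℕ} → (Fin k → ℕ) → ℕ → Set
Monochromatic col xs y = (i : _) → col (xs i) ≡ col y

NoMonoSolution : (m a N : ℕ) → (ℕ → Colour) → Set
NoMonoSolution m a N col =
  (xs : Fin (m ∸ 1) → ℕ) (y : ℕ) →
  IsSolution m a N xs y → ¬ Monochromatic col xs y

module Submission where

-- Write k = m - 1, so a solution consists of k summands
-- x₁,…,x_k and a right-hand side y with x₁ + ⋯ + x_k = a·y.  All solutions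
-- used below take only two values: j summands equal to u and k - j equal to v.
-- Suppose a - 2 is red and a - 1 is blue, and put k = 2a + r.
--   * If a were blue, then 2a copies of a - 1 and r copies of a (sum a(k-2))
--     with y = k - 2 would be blue unless k - 2 is red; but then 2 copies of
--     k - 2 and k - 2 copies of a - 2 (sum a(k-2)) with y = k - 2 would be a
--     red solution.  Hence a is red.
--   * k copies of a with y = k form a solution, so k has the other colour.
-- All numbers used are at most k, and k ≤ C(m,a) because a² ≤ k.

open import Defs
open import Data.Nat using (ℕ; zero; suc; z≤n; s≤s; _+_; _*_; _∸_; _≤_; NonZero)
open import Data.Nat.Properties
open import Data.Nat.DivMod using (_/_; _%_; m≡m%n+[m/n]*n; m%n<n)
open import Data.Nat.Tactic.RingSolver using (solve-∀)
open import Data.Fin using (Fin; toℕ)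
open import Data.Product using (_×_; _,_)
open import Data.Sum using (_⊎_; inj₁; inj₂)
open import Data.Empty using (⊥)
open import Relation.Nullary using (¬_)
open import Relation.Binary.PropositionalEquality
  using (_≡_; refl; sym; trans; cong; subst)

notBlue⇒red : {c : Colour} → ¬ c ≡ blue → c ≡ red
notBlue⇒red {red}  _   = refl
notBlue⇒red {blue} c≢b with c≢b refl
... | ()

notRed⇒blue : {c : Colour} → ¬ c ≡ red → c ≡ blue
notRed⇒blue {blue} _   = refl
notRed⇒blue {red}  c≢r with c≢r refl
... | ()

twoBlock : ℕ → ℕ → ℕ → ℕ → ℕ
twoBlock u v zero    t       = v
twoBlock u v (suc j) zero    = u
twoBlock u v (suc j) (suc t) = twoBlock u v j t

twoBlock-either : ∀ u v j t → twoBlock u v j t ≡ u ⊎ twoBlock u v j t ≡ v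
twoBlock-either u v zero    t       = inj₂ refl
twoBlock-either u v (suc j) zero    = inj₁ refl
twoBlock-either u v (suc j) (suc t) = twoBlock-either u v j t

twoBlock-all : (P : ℕ → Set) → ∀ {u v} j t → P u → P v → P (twoBlock u v j t)
twoBlock-all P {u} {v} j t pu pv with twoBlock-either u v j t
... | inj₁ e = subst P (sym e) pu
... | inj₂ e = subst P (sym e) pv

sum-twoBlock : ∀ u v n j → j ≤ n →
               sumFin {n} (λ i → twoBlock u v j (toℕ i)) ≡ j * u + (n ∸ j) * v
sum-twoBlock u v zero    zero    z≤n      = refl
sum-twoBlock u v (suc n) zero    z≤n      = cong (v +_) (sum-twoBlock u v n zero z≤n)
sum-twoBlock u v (suc n) (suc j) (s≤s j≤n) =
  trans (cong (u +_) (sum-twoBlock u v n j j≤n)) (sym (+-assoc u (j * u) ((n ∸ j) * v)))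

twoBlockSolution : ∀ {k N} {col : ℕ → Colour} a j u v y → NoMonoSolution (suc k) a N col →
                   j ≤ k → InRange N u → InRange N v → InRange N y →
                   j * u + (k ∸ j) * v ≡ a * y →
                   col u ≡ col y → col v ≡ col y → ⊥
twoBlockSolution {k} {N} {col} a j u v y noMono j≤k u∈ v∈ y∈ sum≡ cu cv =
  noMono xs y ((λ i → twoBlock-all (InRange N) j (toℕ i) u∈ v∈) , y∈ ,
               trans (sum-twoBlock u v k j j≤k) sum≡)
         (λ i → twoBlock-all (λ x → col x ≡ col y) j (toℕ i) cu cv)
  where
  xs : Fin k → ℕ
  xs i = twoBlock u v j (toℕ i)

-- k copies of a with right-hand side k form a solution (k·a = a·k), so
-- a and k must have different colours.
constantSolution : ∀ {k a N col} → NoMonoSolution (suc k) a N col →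
                   InRange N a → InRange N k → col a ≡ col k → ⊥
constantSolution {k} {a} noMono a∈ k∈ ca =
  twoBlockSolution a k a a k noMono ≤-refl a∈ a∈ k∈
    (trans (cong (λ z → k * a + z * a) (n∸n≡0 k)) (trans (+-identityʳ (k * a)) (*-comm k a)))
    ca ca

≤ceilDiv*d : ∀ n d → n ≤ ceilDiv n (suc d) * suc d
≤ceilDiv*d n d = +-cancelʳ-≤ d n (q * suc d) (begin
  n + d                ≡⟨ m≡m%n+[m/n]*n (n + d) (suc d) ⟩
  (n + d) % suc d + q * suc d ≤⟨ +-monoˡ-≤ (q * suc d) (≤-pred (m%n<n (n + d) (suc d))) ⟩
  d + q * suc d        ≡⟨ +-comm d (q * suc d) ⟩
  q * suc d + d        ∎)
  where
  open ≤-Reasoning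
  q = (n + d) / suc d

-- If a² ≤ k then ⌈k/a⌉ ≥ a, hence ⌈k·⌈k/a⌉/a⌉ ≥ k.
k≤C : ∀ d k → suc d * suc d ≤ k → k ≤ C (suc k) (suc d)
k≤C d k a²≤k = *-cancelʳ-≤ k (C (suc k) a) a (begin
  k * a                    ≤⟨ *-monoʳ-≤ k a≤q ⟩
  k * q                    ≤⟨ ≤ceilDiv*d (k * q) d ⟩
  C (suc k) a * a          ∎)
  where
  open ≤-Reasoning
  a = suc d
  q = ceilDiv k a
  a≤q : a ≤ q
  a≤q = *-cancelʳ-≤ a q a (≤-trans a²≤k (≤ceilDiv*d k d))

a²≤m-1 : ∀ a k .{{_ : NonZero a}} → 2 * (a * a) ∸ a + 2 ≤ suc k → a * a ≤ k
a²≤m-1 a k bound = ≤-pred (begin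
  suc (a * a)          ≤⟨ n≤1+n (suc (a * a)) ⟩
  2 + a * a            ≡⟨ +-comm 2 (a * a) ⟩
  a * a + 2            ≤⟨ +-monoˡ-≤ 2 a²≤ ⟩
  2 * (a * a) ∸ a + 2  ≤⟨ bound ⟩
  suc k                ∎)
  where
  open ≤-Reasoning
  a²+a≤2a² : a * a + a ≤ 2 * (a * a)
  a²+a≤2a² = +-monoʳ-≤ (a * a) (subst (a ≤_) (sym (+-identityʳ (a * a))) (m≤m*n a a))
  a²≤ : a * a ≤ 2 * (a * a) ∸ a
  a²≤ = m+n≤o⇒m≤o∸n (a * a) a²+a≤2a²

-- With a = b + 3, k = 2a + r and y = k - 2: the blue solution
-- (2a copies of a - 1, r copies of a) and the red solution
-- (2 copies of y, y copies of a - 2), both with right-hand side y.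
k≡2+y : ∀ b r → 2 * (3 + b) + r ≡ 2 + (4 + 2 * b + r)
k≡2+y = solve-∀

blueIdentity : ∀ b r → 2 * (3 + b) * (2 + b) + r * (3 + b) ≡ (3 + b) * (4 + 2 * b + r)
blueIdentity = solve-∀

redIdentity : ∀ y b → 2 * y + y * (1 + b) ≡ (3 + b) * y
redIdentity = solve-∀

aRed : ∀ b r {N col} → NoMonoSolution (suc (2 * (3 + b) + r)) (3 + b) N col →
       2 * (3 + b) + r ≤ N → col (1 + b) ≡ red → col (2 + b) ≡ blue → col (3 + b) ≡ red
aRed b r {N} {col} noMono k≤N a-2red a-1blue = notBlue⇒red aNotBlue
  where
  a = 3 + b
  k = 2 * a + r
  y = 4 + 2 * b + r
  a≤k : a ≤ k
  a≤k = ≤-trans (m≤m+n a (a + 0)) (m≤m+n (2 * a) r)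
  y≤k : y ≤ k
  y≤k = subst (y ≤_) (sym (k≡2+y b r)) (m≤n+m y 2)
  a∈ : InRange N a
  a∈ = s≤s z≤n , ≤-trans a≤k k≤N
  a-1∈ : InRange N (2 + b)
  a-1∈ = s≤s z≤n , ≤-trans (n≤1+n (2 + b)) (≤-trans a≤k k≤N)
  a-2∈ : InRange N (1 + b)
  a-2∈ = s≤s z≤n , ≤-trans (n≤1+n (1 + b)) (≤-trans (n≤1+n (2 + b)) (≤-trans a≤k k≤N))
  y∈ : InRange N y
  y∈ = s≤s z≤n , ≤-trans y≤k k≤N
  blueSum : 2 * a * (2 + b) + (k ∸ 2 * a) * a ≡ a * y
  blueSum = trans (cong (λ z → 2 * a * (2 + b) + z * a) (m+n∸m≡n (2 * a) r)) (blueIdentity b r)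
  redSum : 2 * y + (k ∸ 2) * (1 + b) ≡ a * y
  redSum = trans (cong (λ z → 2 * y + z * (1 + b)) (cong (_∸ 2) (k≡2+y b r))) (redIdentity y b)
  -- if a were blue, the blue solution forces y to be red ...
  yRed : col a ≡ blue → col y ≡ red
  yRed aBlue = notBlue⇒red λ yBlue →
    twoBlockSolution a (2 * a) (2 + b) a y noMono (m≤m+n (2 * a) r) a-1∈ a∈ y∈ blueSum
      (trans a-1blue (sym yBlue)) (trans aBlue (sym yBlue))
  -- ... and then the red solution is monochromatic.
  aNotBlue : ¬ col a ≡ blue
  aNotBlue aBlue =
    twoBlockSolution a 2 y (1 + b) y noMono (≤-trans (s≤s (s≤s z≤n)) a≤k) y∈ a-2∈ y∈ redSum
      refl (trans a-2red (sym (yRed aBlue)))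

forcedColours : ∀ b k {N} {col : ℕ → Colour} → 2 * (3 + b) ≤ k → NoMonoSolution (suc k) (3 + b) N col →
                k ≤ N → col (1 + b) ≡ red → col (2 + b) ≡ blue →
                col (3 + b) ≡ red × col k ≡ blue
forcedColours b k {col = col} 2a≤k noMono k≤N a-2red a-1blue with m≤n⇒∃[o]m+o≡n 2a≤k
... | r , refl = aIsRed , notRed⇒blue kNotRed
  where
  aIsRed : col (3 + b) ≡ red
  aIsRed = aRed b r noMono k≤N a-2red a-1blue
  kNotRed : ¬ col k ≡ red
  kNotRed kRed = constantSolution noMono
    (s≤s z≤n , ≤-trans (≤-trans (m≤m+n (3 + b) _) 2a≤k) k≤N)
    (≤-trans (s≤s z≤n) 2a≤k , k≤N)
    (trans aIsRed (sym kRed))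

lemma3 : (a m : ℕ) → 3 ≤ a → 2 * (a * a) ∸ a + 2 ≤ m →
         (col : ℕ → Colour) →
         NoMonoSolution m a (C m a) col →
         col (a ∸ 2) ≡ red → col (a ∸ 1) ≡ blue →
         col a ≡ red × col (m ∸ 1) ≡ blue
lemma3 a zero _ bound _ _ _ _ with m+n≤o⇒n≤o (2 * (a * a) ∸ a) bound
... | ()
lemma3 a@(suc (suc (suc b))) (suc k) (s≤s (s≤s (s≤s z≤n))) bound col noMono a-2red a-1blue =
  forcedColours b k 2a≤k noMono (k≤C (2 + b) k a²≤k) a-2red a-1blue
  where
  a²≤k : a * a ≤ k
  a²≤k = a²≤m-1 a k bound
  2a≤k : 2 * a ≤ k
  2a≤k = ≤-trans (*-monoˡ-≤ a {2} {a} (s≤s (s≤s z≤n))) a²≤k
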